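{- Let $G$ be a graph and let $\mathcal{Q}$ be a partition of $V(G)$ into cliques each of size $2$. Then $\mathcal{Q}$ is a frozen clique partition of $G$ if and only if every triangle of $G$ intersects three distinct cliques of $\mathcal{Q}$.
   Context: A clique partition $\mathcal{Q}$ of $G$ is frozen if every vertex $v$ has a non-neighbour in each clique of $\mathcal{Q}$ other than the one containing $v$. -}

module Defs where

open import Level using (0ℓ)
open import Data.Nat using (ℕ)
open import Data.Fin using (Fin)
open import Data.Product using (Σ; ∃; _×_; _,_)
open import Data.Sum using (_⊎_)
open import Relation.Nullary using (¬_)
open import Relation.Binary.PropositionalEquality using (_≡_; _≢_)
open import Relation.Binary.Core using (Rel)
open import Relation.Binary.Definitions using (Decidable; Symmetric; Irreflexive)

record Graph (n : ℕ) : Set₁ where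
  field
    Adj   : Rel (Fin n) 0ℓ
    adj?  : Decidable Adj
    sym   : Symmetric Adj
    irrefl : Irreflexive _≡_ Adj

record Partition (n k : ℕ) : Set where
  field
    part    : Fin n → Fin k
    nonempty : (i : Fin k) → ∃ λ v → part v ≡ i

open Partition public

module _ {n : ℕ} (G : Graph n) where
  open Graph G

  IsCliquePartition : {k : ℕ} → Partition n k → Set
  IsCliquePartition Q = ∀ u v → part Q u ≡ part Q v → u ≢ v → Adj u v

  Frozen : {k : ℕ} → Partition n k → Set
  Frozen {k} Q = ∀ (v : Fin n) (j : Fin k) → j ≢ part Q v →
               ∃ λ u → part Q u ≡ j × ¬ Adj v u

  Triangle : Fin n → Fin n → Fin n → Set
  Triangle a b c = Adj a b × Adj b c × Adj a c

AllPartsSize2 : {n k : ℕ} → Partition n k → Set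
AllPartsSize2 {n} {k} Q = (i : Fin k) → Σ (Fin n) λ a → Σ (Fin n) λ b →
  a ≢ b × part Q a ≡ i × part Q b ≡ i × (∀ v → part Q v ≡ i → v ≡ a ⊎ v ≡ b)

{-# OPTIONS --safe #-}
-- Both conditions say that no vertex is adjacent to both vertices of a
-- clique of Q.  For frozenness this is immediate since every clique is a
-- pair; for triangles, a common neighbour v of a clique {x, y} spans the
-- triangle v x y, and conversely a triangle with two vertices in one clique
-- has its third vertex as a common neighbour of that clique.
module Submission where

open import Defs
open import Data.Nat using (ℕ)
open import Data.Fin using (Fin; _≟_)
open import Data.Product using (_×_; _,_)
open import Data.Sum using (_⊎_; inj₁; inj₂; swap)
open import Data.Empty using (⊥; ⊥-elim)
open import Function.Base using (_∘_)
open import Relation.Nullary using (yes; no)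
open import Relation.Binary.PropositionalEquality using (_≡_; _≢_; refl; sym; trans)
open import Function.Bundles using (_⇔_; mk⇔)

⊆pair⇒⊆distinctPair : ∀ {A : Set} {P : A → Set} {x y a b u : A} →
  (∀ v → P v → v ≡ x ⊎ v ≡ y) → a ≢ b → P a → P b → P u → u ≡ a ⊎ u ≡ b
⊆pair⇒⊆distinctPair ⊆xy a≢b pa pb pu with ⊆xy _ pa | ⊆xy _ pb
... | inj₁ refl | inj₁ refl = ⊥-elim (a≢b refl)
... | inj₂ refl | inj₂ refl = ⊥-elim (a≢b refl)
... | inj₁ refl | inj₂ refl = ⊆xy _ pu
... | inj₂ refl | inj₁ refl = swap (⊆xy _ pu)

module _ {n k : ℕ} (Q : Partition n k) where

  size2⇒block≡pair : AllPartsSize2 Q → ∀ {x y} → x ≢ y → part Q x ≡ part Q y →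
                     ∀ u → part Q u ≡ part Q x → u ≡ x ⊎ u ≡ y
  size2⇒block≡pair size2 {x} x≢y px≡py u pu≡px with size2 (part Q x)
  ... | _ , _ , _ , _ , _ , ⊆ab = ⊆pair⇒⊆distinctPair ⊆ab x≢y refl (sym px≡py) pu≡px

module _ {n : ℕ} (G : Graph n) where
  open Graph G renaming (sym to Adj-sym)

  Adj⇒≢ : ∀ {u v} → Adj u v → u ≢ v
  Adj⇒≢ uv refl = irrefl refl uv

  module _ {k : ℕ} (Q : Partition n k) where

    NoCommonNeighbourInBlock : Set
    NoCommonNeighbourInBlock = ∀ {v x y} → x ≢ y → part Q x ≡ part Q y →
                               Adj v x → Adj v y → ⊥

    RainbowTriangles : Set
    RainbowTriangles = ∀ a b c → Triangle G a b c →
                       part Q a ≢ part Q b × part Q b ≢ part Q c × part Q a ≢ part Q c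

    frozen⇒noCommonNeighbourOfPairBlock : Frozen G Q → ∀ {v x y} →
      (∀ u → part Q u ≡ part Q x → u ≡ x ⊎ u ≡ y) → Adj v x → Adj v y → ⊥
    frozen⇒noCommonNeighbourOfPairBlock frozen {v} {x} block⊆xy vx vy
      with part Q x ≟ part Q v
    ... | yes px≡pv with block⊆xy v (sym px≡pv)
    ...   | inj₁ refl = irrefl refl vx
    ...   | inj₂ refl = irrefl refl vy
    frozen⇒noCommonNeighbourOfPairBlock frozen {v} {x} block⊆xy vx vy
        | no px≢pv with frozen v (part Q x) px≢pv
    ...   | u , pu≡px , ¬vu with block⊆xy u pu≡px
    ...     | inj₁ refl = ¬vu vx
    ...     | inj₂ refl = ¬vu vy

    frozen⇒noCommonNeighbourInBlock : AllPartsSize2 Q → Frozen G Q →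
                                      NoCommonNeighbourInBlock
    frozen⇒noCommonNeighbourInBlock size2 frozen x≢y px≡py =
      frozen⇒noCommonNeighbourOfPairBlock frozen (size2⇒block≡pair Q size2 x≢y px≡py)

    noCommonNeighbourInBlock⇒frozen : AllPartsSize2 Q → NoCommonNeighbourInBlock →
                                      Frozen G Q
    noCommonNeighbourInBlock⇒frozen size2 noCommon v j _ with size2 j
    ... | x , y , x≢y , px , py , _ with adj? v x | adj? v y
    ...   | no ¬vx | _      = x , px , ¬vx
    ...   | yes _  | no ¬vy = y , py , ¬vy
    ...   | yes vx | yes vy = ⊥-elim (noCommon x≢y (trans px (sym py)) vx vy)

    noCommonNeighbourInBlock⇒rainbow : NoCommonNeighbourInBlock → RainbowTriangles
    noCommonNeighbourInBlock⇒rainbow noCommon a b c (ab , bc , ac) =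
        (λ pa≡pb → noCommon (Adj⇒≢ ab) pa≡pb (Adj-sym ac) (Adj-sym bc))
      , (λ pb≡pc → noCommon (Adj⇒≢ bc) pb≡pc ab ac)
      , (λ pa≡pc → noCommon (Adj⇒≢ ac) pa≡pc (Adj-sym ab) bc)

    rainbow⇒noCommonNeighbourInBlock : IsCliquePartition G Q → RainbowTriangles →
                                       NoCommonNeighbourInBlock
    rainbow⇒noCommonNeighbourInBlock clique rainbow {v} {x} {y} x≢y px≡py vx vy
      with rainbow v x y (vx , clique x y px≡py x≢y , vy)
    ... | _ , px≢py , _ = px≢py px≡py

lemma3 : (n k : ℕ) (G : Graph n) (Q : Partition n k) →
           IsCliquePartition G Q → AllPartsSize2 Q →
           Frozen G Q ⇔
             (∀ (a b c : Fin n) → Triangle G a b c →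
                part Q a ≢ part Q b × part Q b ≢ part Q c × part Q a ≢ part Q c)
lemma3 n k G Q clique size2 = mk⇔
  (noCommonNeighbourInBlock⇒rainbow G Q ∘ frozen⇒noCommonNeighbourInBlock G Q size2)
  (noCommonNeighbourInBlock⇒frozen G Q size2 ∘ rainbow⇒noCommonNeighbourInBlock G Q clique)
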